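{- If $G$ is an $n$-connector, then $G$ is $(k,n-k)$-ST-robust for all $1\le k\le n$.
   Context: A DAG $G$ with $n$ inputs and $n$ outputs is an $n$-connector if for every $1\le r\le n$, every ordered list $x_1,\dots,x_r$ of distinct inputs and every ordered list $y_1,\dots,y_r$ of distinct outputs, there are $r$ vertex-disjoint paths in $G$ connecting $x_i$ to $y_i$ for each $i\le r$. For a DAG $G=(V,E)$ with a set $I$ of $n$ inputs and a set $O$ of $n$ outputs, $G$ is $(k_1,k_2)$-ST-robust if for every $D\subseteq V$ with $|D|\le k_1$ there is a subgraph $H$ of $G-D$ with $|I\cap V(H)|\ge k_2$ and $|O\cap V(H)|\ge k_2$ such that for every $s\in I\cap V(H)$ and every $t\in O\cap V(H)$ there is a directed path from $s$ to $t$ in $H$. -}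

module Defs where

open import Data.Nat using (ℕ; _≤_)
open import Data.Fin using (Fin)
open import Data.Fin.Subset using (Subset; _∈_; _∩_; ∣_∣)
open import Data.List using (List; []; _∷_; [_])
import Data.List.Membership.Propositional as LM
open import Data.Product using (Σ; ∃; _×_; _,_)
open import Data.Empty using (⊥)
open import Relation.Binary.PropositionalEquality using (_≡_; _≢_)
open import Function.Definitions using (Injective)
open import Level using (0ℓ)

data Walk {N : ℕ} (E : Fin N → Fin N → Set) : Fin N → Fin N → List (Fin N) → Set where
  single : ∀ {x} → Walk E x x [ x ]
  step   : ∀ {x y z vs} → E x y → Walk E y z vs → Walk E x z (x ∷ vs)

record DAG (n : ℕ) : Set₁ where
  field
    N       : ℕ
    E       : Fin N → Fin N → Set
    acyclic : ∀ x vs → Walk E x x vs → vs ≡ [ x ]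
    I       : Subset N
    O       : Subset N
    ∣I∣≡n   : ∣ I ∣ ≡ n
    ∣O∣≡n   : ∣ O ∣ ≡ n

module _ {n : ℕ} (G : DAG n) where
  open DAG G

  DisjointL : List (Fin N) → List (Fin N) → Set
  DisjointL as bs = ∀ v → v LM.∈ as → v LM.∈ bs → ⊥

  Connector : Set
  Connector =
    ∀ (r : ℕ) → 1 ≤ r → r ≤ n →
    (x y : Fin r → Fin N) →
    Injective _≡_ _≡_ x → Injective _≡_ _≡_ y →
    (∀ i → x i ∈ I) → (∀ i → y i ∈ O) →
    Σ (Fin r → List (Fin N)) λ p →
      (∀ i → Walk E (x i) (y i) (p i)) ×
      (∀ i j → i ≢ j → DisjointL (p i) (p j))

  record SubgraphAvoiding (D : Subset N) : Set₁ where
    field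
      S      : Subset N
      F      : Fin N → Fin N → Set
      F⊆E    : ∀ {u v} → F u v → E u v
      F-src  : ∀ {u v} → F u v → u ∈ S
      F-tgt  : ∀ {u v} → F u v → v ∈ S
      S∩D=∅  : ∀ v → v ∈ S → v ∈ D → ⊥

  STRobust : ℕ → ℕ → Set₁
  STRobust k₁ k₂ =
    ∀ (D : Subset N) → ∣ D ∣ ≤ k₁ →
    Σ (SubgraphAvoiding D) λ H →
      let open SubgraphAvoiding H in
      (k₂ ≤ ∣ I ∩ S ∣) × (k₂ ≤ ∣ O ∩ S ∣) ×
      (∀ s t → s ∈ I → s ∈ S → t ∈ O → t ∈ S → ∃ λ vs → Walk F s t vs)

-- Fix D with ∣ D ∣ ≤ k. Call a path from an input s to an output t clean if it avoids D and
-- meets I only in s and O only in t. Any matching M of inputs to outputs extends to a perfect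
-- one, and routing that through the connector gives n disjoint paths, each of which meets I and
-- O only at its own ends; so each pair of M either gets a clean path or has its path hit D, and
-- if all of them hit D, disjointness yields an injection of M into D. Hence a maximal matching
-- M of pairs without clean paths has ∣ M ∣ ≤ ∣ D ∣ ≤ k, while every unmatched input is joined
-- to every unmatched output by a clean path. These paths stay among the vertices outside D that
-- are not matched terminals, which form the required subgraph. It retains at least n ∸ k
-- inputs: if some output is unmatched, every unmatched input lies on a clean path to it, and
-- otherwise n ≤ ∣ M ∣ ≤ k. Outputs are symmetric.
module Submission where

open import Defs
open import Data.Nat using (ℕ; zero; suc; _≤_; _+_; _*_; _∸_; z≤n; s≤s)
open import Data.Nat.Properties
  using (≤-reflexive; ≤-trans; ≤-antisym; ≤-<-trans; n≤1+n; suc-injective; +-cancelˡ-≡; m≤m+n; +-identityʳ; +-suc; 1+n≰n; m+n∸m≡n; m≤n⇒m∸n≡0; ∸-monoʳ-≤; module ≤-Reasoning)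
open import Data.Fin as Fin using (Fin; zero; suc; combine)
open import Data.Fin.Properties using (combine-injective; any?)
open import Data.Fin.Subset using (Subset; _∈_; _∉_; _-_; _∩_; ∣_∣; ⊤; inside; outside)
  renaming (⊥ to ∅)
open import Data.Fin.Subset.Properties
  using (p⊆q⇒∣p∣≤∣q∣; ∣⊥∣≡0; ∈⊤; ∣⊤∣≡n; p─⊥≡p; p─q⊆p; x∈p∧x≢y⇒x∈p-y; x∈p⇒∣p-x∣<∣p∣; x∈p∩q⁺)
  renaming (_∈?_ to _∈ₛ?_)
open import Data.List using (List; []; _∷_; _++_; length; map; lookup; filter; allFin; zip)
open import Data.List.Properties using (length-map; length-tabulate; length-++; map-++)
open import Data.List.Membership.Propositional using (find; lose) renaming (_∈_ to _∈ₗ_; _∉_ to _∉ₗ_)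
open import Data.List.Membership.Propositional.Properties
  using (∈-map⁺; ∈-map⁻; ∈-lookup; ∈-tabulate⁻; ∈-allFin; ∈-filter⁺; ∈-filter⁻; ∈-++⁺ˡ; ∈-++⁺ʳ; ∈-++⁻)
import Data.List.Membership.DecPropositional as DecMembership
open import Data.List.Relation.Unary.Any using (Any; here; there; index)
import Data.List.Relation.Unary.Any as Any
open import Data.List.Relation.Unary.Any.Properties using (lookup-index)
import Data.List.Relation.Unary.All as All
open import Data.List.Relation.Unary.All.Properties using (¬Any⇒All¬)
open import Data.List.Relation.Unary.AllPairs using ([]; _∷_)
open import Data.List.Relation.Unary.Unique.Propositional using (Unique)
import Data.List.Relation.Unary.Unique.Propositional.Properties as Unique
open import Data.Product using (Σ; ∃; _×_; _,_; proj₁; proj₂; uncurry)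
open import Data.Product.Properties using (≡-dec)
open import Data.Sum using (_⊎_; inj₁; inj₂; [_,_]′)
open import Data.Vec using (_∷_) renaming (there to thereᵥ)
import Data.Vec as Vec
open import Data.Vec.Properties using (lookup∘tabulate; lookup⇒[]=; []=⇒lookup)
open import Data.Bool.Properties using (T-≡)
open import Function using (_∘_; Equivalence)
open import Level using (0ℓ)
open import Relation.Nullary using (¬_; Dec; yes; no; ¬?; contradiction)
open import Relation.Nullary.Decidable using (decidable-stable; isYes; toWitness; fromWitness; _×-dec_; _→-dec_)
open import Relation.Unary using (Pred; Decidable)
open import Relation.Binary.PropositionalEquality
  using (_≡_; _≢_; refl; sym; trans; cong; subst; ≢-sym; module ≡-Reasoning)

private variable
  m n : ℕ

x∉p-x : ∀ {p : Subset n} {x} → x ∉ p - x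
x∉p-x {p = _ ∷ _} {zero} ()
x∉p-x {p = _ ∷ _} {suc x} (thereᵥ x∈p-x) = x∉p-x x∈p-x

∣p∣≤1+∣p-x∣ : ∀ (p : Subset n) x → ∣ p ∣ ≤ suc ∣ p - x ∣
∣p∣≤1+∣p-x∣ (inside  ∷ p) zero    = ≤-reflexive (cong (suc ∘ ∣_∣) (sym (p─⊥≡p p)))
∣p∣≤1+∣p-x∣ (outside ∷ p) zero    = ≤-trans (n≤1+n _) (≤-reflexive (cong (suc ∘ ∣_∣) (sym (p─⊥≡p p))))
∣p∣≤1+∣p-x∣ (inside  ∷ p) (suc x) = s≤s (∣p∣≤1+∣p-x∣ p x)
∣p∣≤1+∣p-x∣ (outside ∷ p) (suc x) = ∣p∣≤1+∣p-x∣ p x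

unique⊆p⇒length≤∣p∣ : ∀ {xs : List (Fin n)} {p} → Unique xs → (∀ {v} → v ∈ₗ xs → v ∈ p) →
                      length xs ≤ ∣ p ∣
unique⊆p⇒length≤∣p∣ {xs = []}     _             _    = z≤n
unique⊆p⇒length≤∣p∣ {xs = x ∷ xs} (x∉xs ∷ uniq) xs⊆p = ≤-<-trans
  (unique⊆p⇒length≤∣p∣ uniq λ v∈xs →
     x∈p∧x≢y⇒x∈p-y (xs⊆p (there v∈xs)) (≢-sym (All.lookup x∉xs v∈xs)))
  (x∈p⇒∣p-x∣<∣p∣ (xs⊆p (here refl)))

p⊆ys⇒∣p∣≤length : ∀ {p : Subset n} ys → (∀ {v} → v ∈ p → v ∈ₗ ys) → ∣ p ∣ ≤ length ys
p⊆ys⇒∣p∣≤length {n} {p} [] p⊆[] =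
  ≤-trans (p⊆q⇒∣p∣≤∣q∣ {q = ∅} (λ v∈p → contradiction (p⊆[] v∈p) λ ())) (≤-reflexive (∣⊥∣≡0 n))
p⊆ys⇒∣p∣≤length {p = p} (y ∷ ys) p⊆y∷ys =
  ≤-trans (∣p∣≤1+∣p-x∣ p y) (s≤s (p⊆ys⇒∣p∣≤length ys p-y⊆ys))
  where
  p-y⊆ys : ∀ {v} → v ∈ p - y → v ∈ₗ ys
  p-y⊆ys v∈p-y with p⊆y∷ys (p─q⊆p p _ v∈p-y)
  ... | here refl  = contradiction v∈p-y x∉p-x
  ... | there v∈ys = v∈ys

injective⇒≤∣p∣ : ∀ {p : Subset n} (f : Fin m → Fin n) → (∀ {i j} → f i ≡ f j → i ≡ j) →
                 (∀ i → f i ∈ p) → m ≤ ∣ p ∣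
injective⇒≤∣p∣ {p = p} f f-injective f∈p = subst (_≤ ∣ p ∣) (length-tabulate f)
  (unique⊆p⇒length≤∣p∣ (Unique.tabulate⁺ f-injective) λ v∈image →
     let i , v≡fi = ∈-tabulate⁻ v∈image in subst (_∈ p) (sym v≡fi) (f∈p i))

unique-pairs⇒length≤* : ∀ {ps : List (Fin m × Fin n)} → Unique ps → length ps ≤ m * n
unique-pairs⇒length≤* {m} {n} {ps} uniq = begin
  length ps                         ≡⟨ length-map (uncurry combine) ps ⟨
  length (map (uncurry combine) ps) ≤⟨ unique⊆p⇒length≤∣p∣ (Unique.map⁺ combine-pair-injective uniq) (λ _ → ∈⊤) ⟩
  ∣ ⊤ {m * n} ∣                     ≡⟨ ∣⊤∣≡n (m * n) ⟩
  m * n                             ∎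
  where
  open ≤-Reasoning
  combine-pair-injective : ∀ {p q : Fin m × Fin n} → uncurry combine p ≡ uncurry combine q → p ≡ q
  combine-pair-injective {i , j} {k , l} eq with refl , refl ← combine-injective i j k l eq = refl

module _ {N : ℕ} where
  open DecMembership (Fin._≟_ {N}) using () renaming (_∈?_ to _∈ₗ?_)

  free? : ∀ p xs → Decidable (λ v → v ∈ p × v ∉ₗ xs)
  free? p xs v = v ∈ₛ? p ×-dec ¬? (v ∈ₗ? xs)

  free : Subset N → List (Fin N) → List (Fin N)
  free p xs = filter (free? p xs) (allFin N)

  module _ {p : Subset N} {xs : List (Fin N)} where

    ∈-free⁺ : ∀ {v} → v ∈ p → v ∉ₗ xs → v ∈ₗ free p xs
    ∈-free⁺ v∈p v∉xs = ∈-filter⁺ (free? p xs) (∈-allFin _) (v∈p , v∉xs)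

    ∈-free⁻ : ∀ {v} → v ∈ₗ free p xs → v ∈ p × v ∉ₗ xs
    ∈-free⁻ = proj₂ ∘ ∈-filter⁻ (free? p xs) {xs = allFin N}

    free-unique : Unique (free p xs)
    free-unique = Unique.filter⁺ (free? p xs) (Unique.allFin⁺ N)

    ++-free-unique : Unique xs → Unique (xs ++ free p xs)
    ++-free-unique uniq = Unique.++⁺ uniq free-unique λ (v∈xs , v∈free) → proj₂ (∈-free⁻ v∈free) v∈xs

    ++-free⊆p : (∀ {v} → v ∈ₗ xs → v ∈ p) → ∀ {v} → v ∈ₗ xs ++ free p xs → v ∈ p
    ++-free⊆p xs⊆p v∈ with ∈-++⁻ xs v∈
    ... | inj₁ v∈xs   = xs⊆p v∈xs
    ... | inj₂ v∈free = proj₁ (∈-free⁻ v∈free)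

    p⊆++-free : ∀ {v} → v ∈ p → v ∈ₗ xs ++ free p xs
    p⊆++-free {v} v∈p with v ∈ₗ? xs
    ... | yes v∈xs = ∈-++⁺ˡ v∈xs
    ... | no  v∉xs = ∈-++⁺ʳ xs (∈-free⁺ v∈p v∉xs)

    length-free : Unique xs → (∀ {v} → v ∈ₗ xs → v ∈ p) → length xs + length (free p xs) ≡ ∣ p ∣
    length-free uniq xs⊆p = trans (sym (length-++ xs)) (≤-antisym
      (unique⊆p⇒length≤∣p∣ (++-free-unique uniq) (++-free⊆p xs⊆p))
      (p⊆ys⇒∣p∣≤length _ p⊆++-free))

    free⊆q⇒∣p∣∸k≤∣p∩q∣ : ∀ {q k} → Unique xs → (∀ {v} → v ∈ₗ xs → v ∈ p) → length xs ≤ k →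
                          (∀ {v} → v ∈ₗ free p xs → v ∈ q) → ∣ p ∣ ∸ k ≤ ∣ p ∩ q ∣
    free⊆q⇒∣p∣∸k≤∣p∩q∣ {q} {k} uniq xs⊆p xs≤k free⊆q = begin
      ∣ p ∣ ∸ k                                     ≤⟨ ∸-monoʳ-≤ ∣ p ∣ xs≤k ⟩
      ∣ p ∣ ∸ length xs                             ≡⟨ cong (_∸ length xs) (length-free uniq xs⊆p) ⟨
      length xs + length (free p xs) ∸ length xs ≡⟨ m+n∸m≡n (length xs) _ ⟩
      length (free p xs)                            ≤⟨ unique⊆p⇒length≤∣p∣ free-unique
                                                         (λ v∈ → x∈p∩q⁺ (proj₁ (∈-free⁻ v∈) , free⊆q v∈)) ⟩
      ∣ p ∩ q ∣                                     ∎
      where open ≤-Reasoning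

    free≡[]⇒∣p∣≤length : free p xs ≡ [] → ∣ p ∣ ≤ length xs
    free≡[]⇒∣p∣≤length free≡[] = p⊆ys⇒∣p∣≤length xs λ v∈p → p⊆xs v∈p
      where
      p⊆xs : ∀ {v} → v ∈ p → v ∈ₗ xs
      p⊆xs v∈p with ∈-++⁻ xs (p⊆++-free v∈p)
      ... | inj₁ v∈xs   = v∈xs
      ... | inj₂ v∈free = contradiction (subst (_ ∈ₗ_) free≡[] v∈free) λ ()

  linked-free⇒∣p∣∸k≤∣p∩q∣ : ∀ {p p′ q : Subset N} {xs ys k} → ∣ p ∣ ≡ ∣ p′ ∣ →
    Unique xs → (∀ {v} → v ∈ₗ xs → v ∈ p) → length xs ≤ k → length ys ≤ k →
    (∀ {v w} → v ∈ₗ free p xs → w ∈ₗ free p′ ys → v ∈ q) → ∣ p ∣ ∸ k ≤ ∣ p ∩ q ∣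
  linked-free⇒∣p∣∸k≤∣p∩q∣ {p} {p′} {q} {xs} {ys} {k} ∣p∣≡∣p′∣ uniq xs⊆p xs≤k ys≤k linked
    with free p′ ys in free′≡
  ... | []    = subst (_≤ ∣ p ∩ q ∣) (sym (m≤n⇒m∸n≡0 ∣p∣≤k)) z≤n
    where
    ∣p∣≤k : ∣ p ∣ ≤ k
    ∣p∣≤k = ≤-trans (≤-reflexive ∣p∣≡∣p′∣) (≤-trans (free≡[]⇒∣p∣≤length free′≡) ys≤k)
  ... | w ∷ _ = free⊆q⇒∣p∣∸k≤∣p∩q∣ uniq xs⊆p xs≤k λ v∈free → linked v∈free (here refl)

module _ {a b} {A : Set a} {B : Set b} where

  lookup-injective : ∀ {f : A → B} {xs} → Unique (map f xs) →
                     ∀ {i j} → f (lookup xs i) ≡ f (lookup xs j) → i ≡ j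
  lookup-injective {xs = _ ∷ _}  _          {zero}  {zero}  _  = refl
  lookup-injective {f} {_ ∷ xs} uniq {zero} {suc j} eq =
    contradiction (subst (_∈ₗ map f xs) (sym eq) (∈-map⁺ f (∈-lookup j))) (Unique.Unique[x∷xs]⇒x∉xs uniq)
  lookup-injective {f} {_ ∷ xs} uniq {suc i} {zero} eq =
    contradiction (subst (_∈ₗ map f xs) eq (∈-map⁺ f (∈-lookup i))) (Unique.Unique[x∷xs]⇒x∉xs uniq)
  lookup-injective {xs = _ ∷ _}  (_ ∷ uniq) {suc i} {suc j} eq = cong suc (lookup-injective uniq eq)

  map-proj₁-zip : ∀ {xs : List A} {ys : List B} → length xs ≡ length ys → map proj₁ (zip xs ys) ≡ xs
  map-proj₁-zip {[]}     {[]}     _  = refl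
  map-proj₁-zip {x ∷ xs} {y ∷ ys} eq = cong (x ∷_) (map-proj₁-zip (suc-injective eq))

  map-proj₂-zip : ∀ {xs : List A} {ys : List B} → length xs ≡ length ys → map proj₂ (zip xs ys) ≡ ys
  map-proj₂-zip {[]}     {[]}     _  = refl
  map-proj₂-zip {x ∷ xs} {y ∷ ys} eq = cong (y ∷_) (map-proj₂-zip (suc-injective eq))

module _ {ℓ} {N : ℕ} {P : Pred (Fin N) ℓ} (P? : Decidable P) where

  subsetOf : Subset N
  subsetOf = Vec.tabulate (isYes ∘ P?)

  ∈-subsetOf⁺ : ∀ {v} → P v → v ∈ subsetOf
  ∈-subsetOf⁺ {v} pv = lookup⇒[]= v subsetOf
    (trans (lookup∘tabulate _ v) (Equivalence.to T-≡ (fromWitness pv)))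

  ∈-subsetOf⁻ : ∀ {v} → v ∈ subsetOf → P v
  ∈-subsetOf⁻ {v} v∈ = toWitness (Equivalence.from T-≡ (trans (sym (lookup∘tabulate _ v)) ([]=⇒lookup v∈)))

module _ {N : ℕ} {E : Fin N → Fin N → Set} where

  walk-source : ∀ {s t vs} → Walk E s t vs → s ∈ₗ vs
  walk-source single     = here refl
  walk-source (step _ _) = here refl

  walk-target : ∀ {s t vs} → Walk E s t vs → t ∈ₗ vs
  walk-target single     = here refl
  walk-target (step _ w) = there (walk-target w)

  walk-restrict : ∀ {ℓ} {F : Fin N → Fin N → Set} (P : Pred (Fin N) ℓ) →
                  (∀ {u v} → E u v → P u → P v → F u v) →
                  ∀ {s t vs} → Walk E s t vs → (∀ {v} → v ∈ₗ vs → P v) → Walk F s t vs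
  walk-restrict P E⇒F single     _    = single
  walk-restrict P E⇒F (step e w) vs⊆P =
    step (E⇒F e (vs⊆P (here refl)) (vs⊆P (there (walk-source w)))) (walk-restrict P E⇒F w (vs⊆P ∘ there))

module _ {n : ℕ} (G : DAG n) where
  open DAG G
  open DecMembership (Fin._≟_ {N}) using () renaming (_∈?_ to _∈ₗ?_)

  sources targets : List (Fin N × Fin N) → List (Fin N)
  sources = map proj₁
  targets = map proj₂

  record IsMatching (M : List (Fin N × Fin N)) : Set where
    field
      sources-unique : Unique (sources M)
      targets-unique : Unique (targets M)
      sources⊆I      : ∀ {v} → v ∈ₗ sources M → v ∈ I
      targets⊆O      : ∀ {v} → v ∈ₗ targets M → v ∈ O

  []-isMatching : IsMatching []
  []-isMatching = record { sources-unique = [] ; targets-unique = [] ; sources⊆I = λ () ; targets⊆O = λ () }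

  ∷-isMatching : ∀ {M s t} → IsMatching M → s ∈ I → s ∉ₗ sources M → t ∈ O → t ∉ₗ targets M →
                 IsMatching ((s , t) ∷ M)
  ∷-isMatching m s∈I s∉M t∈O t∉M = record
    { sources-unique = ¬Any⇒All¬ _ s∉M ∷ sources-unique
    ; targets-unique = ¬Any⇒All¬ _ t∉M ∷ targets-unique
    ; sources⊆I      = λ { (here refl) → s∈I ; (there v∈M) → sources⊆I v∈M }
    ; targets⊆O      = λ { (here refl) → t∈O ; (there v∈M) → targets⊆O v∈M }
    }
    where open IsMatching m

  completion : List (Fin N × Fin N) → List (Fin N × Fin N)
  completion M = M ++ zip (free I (sources M)) (free O (targets M))

  M⊆completion : ∀ {M q} → q ∈ₗ M → q ∈ₗ completion M
  M⊆completion = ∈-++⁺ˡ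

  module _ {M} (m : IsMatching M) where
    open IsMatching m

    free-lengths-equal : length (free I (sources M)) ≡ length (free O (targets M))
    free-lengths-equal = +-cancelˡ-≡ (length M) _ _ (begin
      length M + length (free I (sources M))          ≡⟨ cong (_+ length (free I (sources M))) (length-map proj₁ M) ⟨
      length (sources M) + length (free I (sources M)) ≡⟨ length-free sources-unique sources⊆I ⟩
      ∣ I ∣                                            ≡⟨ trans ∣I∣≡n (sym ∣O∣≡n) ⟩
      ∣ O ∣                                            ≡⟨ length-free targets-unique targets⊆O ⟨
      length (targets M) + length (free O (targets M)) ≡⟨ cong (_+ length (free O (targets M))) (length-map proj₂ M) ⟩
      length M + length (free O (targets M))          ∎)
      where open ≡-Reasoning

    sources-completion : sources (completion M) ≡ sources M ++ free I (sources M)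
    sources-completion = trans (map-++ proj₁ M _) (cong (sources M ++_) (map-proj₁-zip free-lengths-equal))

    targets-completion : targets (completion M) ≡ targets M ++ free O (targets M)
    targets-completion = trans (map-++ proj₂ M _) (cong (targets M ++_) (map-proj₂-zip free-lengths-equal))

    completion-isMatching : IsMatching (completion M)
    completion-isMatching = record
      { sources-unique = subst Unique (sym sources-completion) (++-free-unique sources-unique)
      ; targets-unique = subst Unique (sym targets-completion) (++-free-unique targets-unique)
      ; sources⊆I      = ++-free⊆p sources⊆I ∘ subst (_ ∈ₗ_) sources-completion
      ; targets⊆O      = ++-free⊆p targets⊆O ∘ subst (_ ∈ₗ_) targets-completion
      }

    I⊆sources-completion : ∀ {v} → v ∈ I → v ∈ₗ sources (completion M)
    I⊆sources-completion = subst (_ ∈ₗ_) (sym sources-completion) ∘ p⊆++-free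

    O⊆targets-completion : ∀ {v} → v ∈ O → v ∈ₗ targets (completion M)
    O⊆targets-completion = subst (_ ∈ₗ_) (sym targets-completion) ∘ p⊆++-free

  record CleanPath (D : Subset N) (s t : Fin N) : Set where
    field
      vertices     : List (Fin N)
      walk         : Walk E s t vertices
      avoids       : ∀ {v} → v ∈ₗ vertices → v ∉ D
      only-input   : ∀ {v} → v ∈ₗ vertices → v ∈ I → v ≡ s
      only-output  : ∀ {v} → v ∈ₗ vertices → v ∈ O → v ≡ t

  record Routing (P : List (Fin N × Fin N)) : Set where
    field
      path     : Fin (length P) → List (Fin N)
      walk     : ∀ i → Walk E (proj₁ (lookup P i)) (proj₂ (lookup P i)) (path i)
      disjoint : ∀ i j → i ≢ j → DisjointL G (path i) (path j)

    owner : ∀ {i j v} → v ∈ₗ path i → v ∈ₗ path j → i ≡ j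
    owner {i} {j} v∈i v∈j = decidable-stable (i Fin.≟ j) λ i≢j → disjoint i j i≢j _ v∈i v∈j

    -- Every terminal is an endpoint of some routed path, so by disjointness it lies on no other path.
    endpoint-unique : ∀ {ℓ} {A : Pred (Fin N) ℓ} (end : Fin N × Fin N → Fin N) →
                      (∀ i → end (lookup P i) ∈ₗ path i) → (∀ {v} → A v → v ∈ₗ map end P) →
                      ∀ i {v} → v ∈ₗ path i → A v → v ≡ end (lookup P i)
    endpoint-unique end end∈path A⊆ends i v∈i v∈A with ∈-map⁻ end (A⊆ends v∈A)
    ... | q , q∈P , refl = cong end (trans (lookup-index q∈P) (cong (lookup P) (owner end∈j v∈i)))
      where
      end∈j : end q ∈ₗ path (index q∈P)
      end∈j = subst (λ q′ → end q′ ∈ₗ path (index q∈P)) (sym (lookup-index q∈P)) (end∈path (index q∈P))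

    clean : ∀ {D} → (∀ {v} → v ∈ I → v ∈ₗ sources P) → (∀ {v} → v ∈ O → v ∈ₗ targets P) →
            ∀ i → ¬ Any (_∈ D) (path i) → CleanPath D (proj₁ (lookup P i)) (proj₂ (lookup P i))
    clean I⊆sources O⊆targets i avoids = record
      { vertices    = path i
      ; walk        = walk i
      ; avoids      = λ v∈i v∈D → avoids (lose v∈i v∈D)
      ; only-input  = endpoint-unique proj₁ (walk-source ∘ walk) I⊆sources i
      ; only-output = endpoint-unique proj₂ (walk-target ∘ walk) O⊆targets i
      }

  route : Connector G → ∀ {P} → IsMatching P → 1 ≤ length P → Routing P
  route connector {P} m 1≤∣P∣
    with connector (length P) 1≤∣P∣ ∣P∣≤n (proj₁ ∘ lookup P) (proj₂ ∘ lookup P)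
                   (lookup-injective sources-unique) (lookup-injective targets-unique)
                   (λ i → sources⊆I (∈-map⁺ proj₁ (∈-lookup i))) (λ i → targets⊆O (∈-map⁺ proj₂ (∈-lookup i)))
    where
    open IsMatching m
    ∣P∣≤n : length P ≤ n
    ∣P∣≤n = begin
      length P           ≡⟨ length-map proj₁ P ⟨
      length (sources P) ≤⟨ unique⊆p⇒length≤∣p∣ sources-unique sources⊆I ⟩
      ∣ I ∣              ≡⟨ ∣I∣≡n ⟩
      n                  ∎
      where open ≤-Reasoning
  ... | path , walk , disjoint = record { path = path ; walk = walk ; disjoint = disjoint }

  module _ (D : Subset N) {M} (m : IsMatching M) (R : Routing (completion M)) where
    open IsMatching m
    open Routing R

    position : Fin (length M) → Fin (length (completion M))
    position j = index (M⊆completion {M} (∈-lookup j))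

    lookup-position : ∀ j → lookup M j ≡ lookup (completion M) (position j)
    lookup-position j = lookup-index (M⊆completion {M} (∈-lookup j))

    blocked⇒length≤∣D∣ : (∀ j → Any (_∈ D) (path (position j))) → length M ≤ ∣ D ∣
    blocked⇒length≤∣D∣ blocked = injective⇒≤∣p∣ hit hit-injective (proj₂ ∘ proj₂ ∘ find ∘ blocked)
      where
      hit : Fin (length M) → Fin N
      hit = proj₁ ∘ find ∘ blocked
      hit-injective : ∀ {i j} → hit i ≡ hit j → i ≡ j
      hit-injective {i} {j} hiti≡hitj = lookup-injective sources-unique (cong proj₁ (begin
        lookup M i                          ≡⟨ lookup-position i ⟩
        lookup (completion M) (position i)  ≡⟨ cong (lookup (completion M)) (owner hit∈i hit∈j) ⟩
        lookup (completion M) (position j)  ≡⟨ lookup-position j ⟨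
        lookup M j                          ∎))
        where
        open ≡-Reasoning
        hit∈i : hit i ∈ₗ path (position i)
        hit∈i = proj₁ (proj₂ (find (blocked i)))
        hit∈j : hit i ∈ₗ path (position j)
        hit∈j = subst (_∈ₗ path (position j)) (sym hiti≡hitj) (proj₁ (proj₂ (find (blocked j))))

    route-or-block : (∃ λ q → q ∈ₗ M × uncurry (CleanPath D) q) ⊎ length M ≤ ∣ D ∣
    route-or-block with any? (λ j → ¬? (Any.any? (_∈ₛ? D) (path (position j))))
    ... | yes (j , avoids) = inj₁ (lookup M j , ∈-lookup j ,
            subst (uncurry (CleanPath D)) (sym (lookup-position j))
              (clean (I⊆sources-completion m) (O⊆targets-completion m) (position j) avoids))
    ... | no none = inj₂ (blocked⇒length≤∣D∣ λ j → decidable-stable (Any.any? (_∈ₛ? D) _) (none ∘ (j ,_)))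

  Saturated : Subset N → List (Fin N × Fin N) → Set
  Saturated D M = ∀ {s t} → s ∈ I → s ∉ₗ sources M → t ∈ O → t ∉ₗ targets M → CleanPath D s t

  record SaturatedMatching (D : Subset N) : Set where
    field
      M          : List (Fin N × Fin N)
      isMatching : IsMatching M
      short      : length M ≤ ∣ D ∣
      saturated  : Saturated D M

  -- E is an arbitrary relation, so whether a pair has a clean path cannot be decided. The search
  -- instead records the clean paths that routing has produced so far and restarts with the empty
  -- matching whenever it produces a new one; as there are at most N * N pairs, this terminates.
  module Search (connector : Connector G) (D : Subset N) where
    open DecMembership (≡-dec (Fin._≟_ {N}) (Fin._≟_ {N})) using () renaming (_∈?_ to _∈ₚ?_)

    Known : Set
    Known = Σ (Fin N × Fin N) (uncurry (CleanPath D))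

    keys : List Known → List (Fin N × Fin N)
    keys = map proj₁

    ∈-keys⇒clean : ∀ {K q} → q ∈ₗ keys K → uncurry (CleanPath D) q
    ∈-keys⇒clean q∈K with ∈-map⁻ proj₁ q∈K
    ... | (_ , c) , _ , refl = c

    Unknown : List Known → List (Fin N × Fin N) → Set
    Unknown K M = ∀ {q} → q ∈ₗ M → q ∉ₗ keys K

    ∷-unknown : ∀ {K M q} → Unknown K M → q ∉ₗ keys K → Unknown K (q ∷ M)
    ∷-unknown unknown q∉K (here refl) = q∉K
    ∷-unknown unknown q∉K (there p∈M) = unknown p∈M

    Open : List Known → List (Fin N × Fin N) → Fin N → Fin N → Set
    Open K M s t = s ∈ I × s ∉ₗ sources M × t ∈ O × t ∉ₗ targets M × (s , t) ∉ₗ keys K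

    open? : ∀ K M → Dec (∃ λ s → ∃ λ t → Open K M s t)
    open? K M = any? λ s → any? λ t →
      s ∈ₛ? I ×-dec ¬? (s ∈ₗ? sources M) ×-dec t ∈ₛ? O ×-dec ¬? (t ∈ₗ? targets M) ×-dec ¬? ((s , t) ∈ₚ? keys K)

    data Progress (K : List Known) (M : List (Fin N × Fin N)) : Set where
      matching-saturated : Saturated D M → Progress K M
      new-clean-path     : (e : Known) → proj₁ e ∉ₗ keys K → Progress K M
      matching-extended  : ∀ {q} → IsMatching (q ∷ M) → Unknown K (q ∷ M) → length (q ∷ M) ≤ ∣ D ∣ → Progress K M

    try-extension : ∀ K {q M} → IsMatching (q ∷ M) → Unknown K (q ∷ M) → Progress K M
    try-extension K m unknown =
      [ (λ (p , p∈M , c) → new-clean-path (p , c) (unknown p∈M)) , matching-extended m unknown ]′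
      (route-or-block D m (route connector (completion-isMatching m) (s≤s z≤n)))

    progress : ∀ K {M} → IsMatching M → Unknown K M → Progress K M
    progress K {M} m unknown with open? K M
    ... | no closed = matching-saturated λ s∈I s∉M t∈O t∉M → ∈-keys⇒clean
            (decidable-stable (_ ∈ₚ? keys K) λ st∉K → closed (_ , _ , s∈I , s∉M , t∈O , t∉M , st∉K))
    ... | yes (s , t , s∈I , s∉M , t∈O , t∉M , st∉K) =
            try-extension K (∷-isMatching m s∈I s∉M t∈O t∉M) (∷-unknown unknown st∉K)

    grow : ∀ K {M} → IsMatching M → Unknown K M → (slack : ℕ) → length M + slack ≡ ∣ D ∣ →
           (∃ λ (e : Known) → proj₁ e ∉ₗ keys K) ⊎ SaturatedMatching D
    grow K {M} m unknown slack eq with progress K m unknown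
    ... | matching-saturated sat = inj₂ (record
            { M = M ; isMatching = m ; short = ≤-trans (m≤m+n _ slack) (≤-reflexive eq) ; saturated = sat })
    ... | new-clean-path e new   = inj₁ (e , new)
    grow K m unknown zero eq | matching-extended _ _ short =
      contradiction (≤-trans short (≤-reflexive (trans (sym eq) (+-identityʳ _)))) 1+n≰n
    grow K m unknown (suc slack) eq | matching-extended m′ unknown′ _ =
      grow K m′ unknown′ slack (trans (sym (+-suc _ slack)) eq)

    saturate : ∀ K → Unique (keys K) → (fuel : ℕ) → length K + fuel ≡ suc (N * N) → SaturatedMatching D
    saturate K uniq fuel eq with grow K []-isMatching (λ ()) ∣ D ∣ refl
    ... | inj₂ done = done
    saturate K uniq zero eq | inj₁ _ =
      contradiction (≤-trans (≤-reflexive (trans (sym eq) (+-identityʳ _))) ∣K∣≤N*N) 1+n≰n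
      where
      ∣K∣≤N*N : length K ≤ N * N
      ∣K∣≤N*N = subst (_≤ N * N) (length-map proj₁ K) (unique-pairs⇒length≤* uniq)
    saturate K uniq (suc fuel) eq | inj₁ (e , new) =
      saturate (e ∷ K) (¬Any⇒All¬ _ new ∷ uniq) fuel (trans (sym (+-suc _ fuel)) eq)

    saturated-matching : SaturatedMatching D
    saturated-matching = saturate [] [] (suc (N * N)) refl

  module Retained (D : Subset N) (sm : SaturatedMatching D) where
    open SaturatedMatching sm
    open IsMatching isMatching

    Admissible : Pred (Fin N) 0ℓ
    Admissible v = v ∉ D × (v ∈ I → v ∉ₗ sources M) × (v ∈ O → v ∉ₗ targets M)

    admissible? : Decidable Admissible
    admissible? v = ¬? (v ∈ₛ? D) ×-dec (v ∈ₛ? I →-dec ¬? (v ∈ₗ? sources M)) ×-dec (v ∈ₛ? O →-dec ¬? (v ∈ₗ? targets M))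

    S : Subset N
    S = subsetOf admissible?

    F : Fin N → Fin N → Set
    F u v = E u v × u ∈ S × v ∈ S

    H : SubgraphAvoiding G D
    H = record { S = S ; F = F ; F⊆E = proj₁ ; F-src = proj₁ ∘ proj₂ ; F-tgt = proj₂ ∘ proj₂
               ; S∩D=∅ = λ v v∈S → proj₁ (∈-subsetOf⁻ admissible? v∈S) }

    clean⊆S : ∀ {s t} → s ∉ₗ sources M → t ∉ₗ targets M → (c : CleanPath D s t) →
              ∀ {v} → v ∈ₗ CleanPath.vertices c → v ∈ S
    clean⊆S s∉M t∉M c v∈c = ∈-subsetOf⁺ admissible?
      ( avoids v∈c
      , (λ v∈I → subst (_∉ₗ sources M) (sym (only-input v∈c v∈I)) s∉M)
      , (λ v∈O → subst (_∉ₗ targets M) (sym (only-output v∈c v∈O)) t∉M) )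
      where open CleanPath c

    connected : ∀ s t → s ∈ I → s ∈ S → t ∈ O → t ∈ S → ∃ λ vs → Walk F s t vs
    connected s t s∈I s∈S t∈O t∈S =
      vertices , walk-restrict (_∈ S) (λ e u∈S v∈S → e , u∈S , v∈S) walk (clean⊆S s∉M t∉M c)
      where
      s∉M : s ∉ₗ sources M
      s∉M = proj₁ (proj₂ (∈-subsetOf⁻ admissible? s∈S)) s∈I
      t∉M : t ∉ₗ targets M
      t∉M = proj₂ (proj₂ (∈-subsetOf⁻ admissible? t∈S)) t∈O
      c : CleanPath D s t
      c = saturated s∈I s∉M t∈O t∉M
      open CleanPath c

    free-linked : ∀ {s t} → s ∈ₗ free I (sources M) → t ∈ₗ free O (targets M) → CleanPath D s t
    free-linked s∈free t∈free with ∈-free⁻ s∈free | ∈-free⁻ t∈free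
    ... | s∈I , s∉M | t∈O , t∉M = saturated s∈I s∉M t∈O t∉M

    ∣sources∣≤k : ∀ {k} → ∣ D ∣ ≤ k → length (sources M) ≤ k
    ∣sources∣≤k ∣D∣≤k = ≤-trans (≤-reflexive (length-map proj₁ M)) (≤-trans short ∣D∣≤k)

    ∣targets∣≤k : ∀ {k} → ∣ D ∣ ≤ k → length (targets M) ≤ k
    ∣targets∣≤k ∣D∣≤k = ≤-trans (≤-reflexive (length-map proj₂ M)) (≤-trans short ∣D∣≤k)

    inputs-retained : ∀ {k} → ∣ D ∣ ≤ k → n ∸ k ≤ ∣ I ∩ S ∣
    inputs-retained {k} ∣D∣≤k = subst (λ i → i ∸ k ≤ ∣ I ∩ S ∣) ∣I∣≡n
      (linked-free⇒∣p∣∸k≤∣p∩q∣ (trans ∣I∣≡n (sym ∣O∣≡n)) sources-unique sources⊆I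
         (∣sources∣≤k ∣D∣≤k) (∣targets∣≤k ∣D∣≤k)
         λ s∈free t∈free → let c = free-linked s∈free t∈free in
           clean⊆S (proj₂ (∈-free⁻ s∈free)) (proj₂ (∈-free⁻ t∈free)) c (walk-source (CleanPath.walk c)))

    outputs-retained : ∀ {k} → ∣ D ∣ ≤ k → n ∸ k ≤ ∣ O ∩ S ∣
    outputs-retained {k} ∣D∣≤k = subst (λ o → o ∸ k ≤ ∣ O ∩ S ∣) ∣O∣≡n
      (linked-free⇒∣p∣∸k≤∣p∩q∣ (trans ∣O∣≡n (sym ∣I∣≡n)) targets-unique targets⊆O
         (∣targets∣≤k ∣D∣≤k) (∣sources∣≤k ∣D∣≤k)
         λ t∈free s∈free → let c = free-linked s∈free t∈free in
           clean⊆S (proj₂ (∈-free⁻ s∈free)) (proj₂ (∈-free⁻ t∈free)) c (walk-target (CleanPath.walk c)))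

  robust-if-saturated : (∀ D → SaturatedMatching D) → ∀ k → STRobust G k (n ∸ k)
  robust-if-saturated saturated-matching k D ∣D∣≤k =
    H , inputs-retained ∣D∣≤k , outputs-retained ∣D∣≤k , connected
    where open Retained D (saturated-matching D)

theorem3 : ∀ (n : ℕ) (G : DAG n) → Connector G →
    ∀ (k : ℕ) → 1 ≤ k → k ≤ n → STRobust G k (n ∸ k)
theorem3 n G connector k _ _ = robust-if-saturated G (Search.saturated-matching G connector) k
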